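{- Let $G$ be an Ore composition of graphs $H_1$ and $H_2$, where $H_1$ is the edge side with deleted edge $xy$ and $H_2$ is the split side with split vertex $z$. Then $$T^{k-1}(G) \geq T^{k-1}(H_1) + T^{k-1}(H_2) - f(H_1,H_2),$$ where $f(H_1,H_2)=2$ if every $(k-1)$-clique packing of $H_1$ contains a clique using the edge $xy$ and every $(k-1)$-clique packing of $H_2$ contains a clique using the vertex $z$; $f(H_1,H_2)=1$ if exactly one of these two conditions holds; and $f(H_1,H_2)=0$ if neither holds.
   Context: Ore composition of $H_1,H_2$: delete an edge $xy$ of $H_1$; split a vertex $z$ of $H_2$ into two vertices $z_1,z_2$ of positive degree with $N(z_1)\cup N(z_2)=N(z)$ and $N(z_1)\cap N(z_2)=\emptyset$; identify $x$ with $z_1$ and $y$ with $z_2$. $T^{k-1}(G)$ is the maximum number of pairwise vertex-disjoint $K_{k-1}$ subgraphs of $G$; a $(k-1)$-clique packing of $G$ is a collection of $T^{k-1}(G)$ pairwise vertex-disjoint $K_{k-1}$ subgraphs of $G$. -}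

module Defs where

open import Data.Nat using (ℕ; zero; suc; _+_; _∸_; _≤_)
open import Data.Fin using (Fin)
open import Data.List using (List; length; concat)
open import Data.List.Membership.Propositional using (_∈_)
open import Data.List.Relation.Unary.All using (All)
open import Data.List.Relation.Unary.Any using (Any)
open import Data.List.Relation.Unary.Unique.Propositional using (Unique)
open import Data.Product using (Σ; _×_; ∃; _,_)
open import Data.Sum using (_⊎_; inj₁; inj₂)
open import Relation.Binary.PropositionalEquality using (_≡_; _≢_)
open import Relation.Nullary using (¬_)

Graph : Set → Set₁
Graph V = V → V → Set

IsSimple : {V : Set} → Graph V → Set
IsSimple {V} A = (∀ u v → A u v → A v u) × (∀ v → ¬ A v v)

IsClique : {V : Set} → Graph V → ℕ → List V → Set
IsClique A m C =
  length C ≡ m × Unique C × (∀ {u v} → u ∈ C → v ∈ C → u ≢ v → A u v)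

-- A collection of pairwise vertex-disjoint K_m subgraphs.
-- (Unique of the concatenation gives both distinct vertices inside a clique
--  and vertex-disjointness of distinct cliques.)
IsPacking : {V : Set} → Graph V → ℕ → List (List V) → Set
IsPacking A m P = All (IsClique A m) P × Unique (concat P)

IsT : {V : Set} → Graph V → ℕ → ℕ → Set
IsT A m t =
  (Σ (List (List _)) λ P → IsPacking A m P × length P ≡ t) ×
  (∀ P → IsPacking A m P → length P ≤ t)

IsCliquePacking : {V : Set} → Graph V → ℕ → List (List V) → Set
IsCliquePacking A m P = IsPacking A m P × (∀ Q → IsPacking A m Q → length Q ≤ length P)

data Indicator (P : Set) : ℕ → Set where
  holds : P → Indicator P 1
  fails : ¬ P → Indicator P 0

-- H1 on Fin n1 with deleted edge xy; H2 on Fin n2 with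
-- split vertex z, where S selects which neighbours of z go to z1
-- (N(z1) = N(z) ∩ S, N(z2) = N(z) \ S).  The vertex z1 is identified with x
-- and z2 with y.
OreV : (n1 n2 : ℕ) → Fin n2 → Set
OreV n1 n2 z = Fin n1 ⊎ (Σ (Fin n2) λ v → v ≢ z)

OreAdj : {n1 n2 : ℕ} → Graph (Fin n1) → Fin n1 → Fin n1 →
         Graph (Fin n2) → (z : Fin n2) → (Fin n2 → Set) → Graph (OreV n1 n2 z)
OreAdj A1 x y A2 z S (inj₁ a) (inj₁ b) =
  A1 a b × ¬ ((a ≡ x × b ≡ y) ⊎ (a ≡ y × b ≡ x))
OreAdj A1 x y A2 z S (inj₂ (u , _)) (inj₂ (v , _)) = A2 u v
OreAdj A1 x y A2 z S (inj₁ a) (inj₂ (v , _)) =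
  (a ≡ x × A2 z v × S v) ⊎ (a ≡ y × A2 z v × ¬ S v)
OreAdj A1 x y A2 z S (inj₂ (v , _)) (inj₁ a) =
  (a ≡ x × A2 z v × S v) ⊎ (a ≡ y × A2 z v × ¬ S v)

-- Take maximum packings P₁ of H₁ and P₂ of H₂ and throw away the "bad" cliques: those of
-- P₁ containing both x and y, and those of P₂ containing z.  Bad cliques of a packing share
-- a vertex, so each side loses at most one clique; and if the indicator is 0 then some
-- maximum packing has no bad clique at all, so that side loses nothing.  The remaining
-- cliques of H₁ avoid the deleted edge and those of H₂ avoid z, so both survive in G,
-- and they are vertex-disjoint there because they live on different sides of G.
module Submission where

open import Defs
open import Data.Nat using (ℕ; suc; _+_; _∸_; _≤_; _≤?_; z≤n; s≤s)
open import Data.Nat.Properties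
  using (≤-reflexive; +-mono-≤; +-monoʳ-≤; +-comm; +-commutativeSemigroup; module ≤-Reasoning)
open import Algebra.Properties.CommutativeSemigroup +-commutativeSemigroup using (interchange)
open import Data.Fin using (Fin; _≟_)
open import Data.List using (List; []; _∷_; _++_; map; concat; filter; length)
open import Data.List.Properties using (length-map; length-++; concat-map; concat-++; filter-all)
open import Data.List.Membership.Propositional using (_∈_; _∉_)
open import Data.List.Membership.Propositional.Properties using (∈-map⁻; ∈-concat⁺′; ∈-concat⁻′)
import Data.List.Membership.DecPropositional as DecMembership
open import Data.List.Relation.Binary.Disjoint.Propositional using (Disjoint)
open import Data.List.Relation.Binary.Sublist.Propositional using (_⊆_; []; _∷_; _∷ʳ_; ⊆-refl; from∈)
open import Data.List.Relation.Binary.Sublist.Propositional.Properties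
  using (++⁺; ++⁺ˡ; All-resp-⊆)
open import Data.List.Relation.Unary.All as All using (All; []; _∷_)
open import Data.List.Relation.Unary.All.Properties
  using (¬Any⇒All¬; all-filter) renaming (filter⁺ to All-filter⁺; ++⁺ to All-++⁺)
open import Data.List.Relation.Unary.Any using (Any; any?)
open import Data.List.Relation.Unary.Unique.Propositional using (Unique; []; _∷_)
open import Data.List.Relation.Unary.Unique.Propositional.Properties
  using () renaming (map⁺ to Unique-map⁺; ++⁺ to Unique-++⁺)
open import Data.Product using (Σ; _×_; _,_; proj₁)
open import Data.Sum using (inj₁; inj₂)
open import Data.Empty using (⊥-elim)
open import Function using (_∘_)
open import Function.Definitions using (Injective)
open import Relation.Nullary using (¬_; yes; no; ¬?; _×-dec_)
open import Relation.Nullary.Decidable using (decidable-stable)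
open import Relation.Unary using (Decidable; ∁)
open import Relation.Binary.PropositionalEquality using (_≡_; _≢_; refl; sym; trans; cong; cong₂; subst)

Unique-resp-⊇ : {V : Set} {xs ys : List V} → ys ⊆ xs → Unique xs → Unique ys
Unique-resp-⊇ []             []         = []
Unique-resp-⊇ (_ ∷ʳ ys⊆xs)   (_ ∷ xs!)  = Unique-resp-⊇ ys⊆xs xs!
Unique-resp-⊇ (refl ∷ ys⊆xs) (x∉ ∷ xs!) = All-resp-⊆ ys⊆xs x∉ ∷ Unique-resp-⊇ ys⊆xs xs!

Unique-++⁻ʳ : {V : Set} (xs : List V) {ys : List V} → Unique (xs ++ ys) → Unique ys
Unique-++⁻ʳ xs = Unique-resp-⊇ (++⁺ˡ xs ⊆-refl)

-- A vertex in both halves would give the sublist [v , v], which is not unique.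
Unique-++⇒Disjoint : {V : Set} {xs ys : List V} → Unique (xs ++ ys) → Disjoint xs ys
Unique-++⇒Disjoint xs++ys! (v∈xs , v∈ys) with Unique-resp-⊇ (++⁺ (from∈ v∈xs) (from∈ v∈ys)) xs++ys!
... | (v≢v ∷ []) ∷ _ = v≢v refl

concat-filter-⊆ : {V : Set} {Keep : List V → Set} (keep? : Decidable Keep) (P : List (List V)) →
                  concat (filter keep? P) ⊆ concat P
concat-filter-⊆ keep? []      = []
concat-filter-⊆ keep? (C ∷ P) with keep? C
... | yes _ = ++⁺ ⊆-refl (concat-filter-⊆ keep? P)
... | no _  = ++⁺ˡ C (concat-filter-⊆ keep? P)

HomomorphicOn : {V W : Set} → Graph V → Graph W → (V → W) → List V → Set
HomomorphicOn A B h C = ∀ {u v} → u ∈ C → v ∈ C → A u v → B (h u) (h v)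

module _ {V W : Set} {A : Graph V} {B : Graph W} {m : ℕ} {h : V → W} (h-injective : Injective _≡_ _≡_ h) where

  map-clique : {C : List V} → HomomorphicOn A B h C → IsClique A m C → IsClique B m (map h C)
  map-clique {C} hom (|C|≡m , C! , adjacent) =
    trans (length-map h C) |C|≡m , Unique-map⁺ h-injective C! , adjacent′
    where
      adjacent′ : ∀ {p q} → p ∈ map h C → q ∈ map h C → p ≢ q → B p q
      adjacent′ p∈ q∈ p≢q with ∈-map⁻ h p∈ | ∈-map⁻ h q∈
      ... | u , u∈ , refl | v , v∈ , refl = hom u∈ v∈ (adjacent u∈ v∈ (p≢q ∘ cong h))

  map-packing : {P : List (List V)} → All (HomomorphicOn A B h) P → IsPacking A m P →
                IsPacking B m (map (map h) P)
  map-packing {P} homs (cliques , P!) =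
    map-all homs cliques , subst Unique (sym (concat-map P)) (Unique-map⁺ h-injective P!)
    where
      map-all : ∀ {P} → All (HomomorphicOn A B h) P → All (IsClique A m) P → All (IsClique B m) (map (map h) P)
      map-all []           []           = []
      map-all (hom ∷ homs) (cl ∷ cls)   = map-clique hom cl ∷ map-all homs cls

++-packing : {V : Set} {A : Graph V} {m : ℕ} {P Q : List (List V)} →
             IsPacking A m P → IsPacking A m Q → Disjoint (concat P) (concat Q) →
             IsPacking A m (P ++ Q)
++-packing {P = P} {Q} (P-cliques , P!) (Q-cliques , Q!) P#Q =
  All-++⁺ P-cliques Q-cliques , subst Unique (concat-++ P Q) (Unique-++⁺ P! Q! P#Q)

module DropBad {V : Set} (A : Graph V) (m : ℕ) {Bad : List V → Set} (bad? : Decidable Bad)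
               {w : V} (bad⇒w∈ : ∀ {C} → Bad C → w ∈ C) where

  dropBad : List (List V) → List (List V)
  dropBad = filter (¬? ∘ bad?)

  dropBad-packing : {P : List (List V)} → IsPacking A m P → IsPacking A m (dropBad P)
  dropBad-packing {P} (cliques , P!) =
    All-filter⁺ (¬? ∘ bad?) cliques , Unique-resp-⊇ (concat-filter-⊆ (¬? ∘ bad?) P) P!

  -- All bad cliques contain w, so in a packing there is at most one of them.
  length≤1+length-dropBad : (P : List (List V)) → IsPacking A m P → length P ≤ suc (length (dropBad P))
  length≤1+length-dropBad []      _ = z≤n
  length≤1+length-dropBad (C ∷ P) (_ ∷ cliques , C++P!) with bad? C
  ... | yes bad-C = ≤-reflexive (cong (suc ∘ length) (sym (filter-all (¬? ∘ bad?) rest-good)))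
    where
      rest-good : All (∁ Bad) P
      rest-good = All.tabulate λ D∈P bad-D →
        Unique-++⇒Disjoint C++P! (bad⇒w∈ bad-C , ∈-concat⁺′ (bad⇒w∈ bad-D) D∈P)
  ... | no _ = s≤s (length≤1+length-dropBad P (cliques , Unique-++⁻ʳ C C++P!))

  GoodPacking : ℕ → ℕ → Set
  GoodPacking t a = Σ (List (List V)) λ Q → IsPacking A m Q × All (∁ Bad) Q × t ≤ a + length Q

  -- Only doubly negated: indicator 0 refutes "every maximum packing has a bad clique"
  -- but does not exhibit a maximum packing without one.
  ¬¬goodPacking : {t a : ℕ} → IsT A m t → Indicator (∀ P → IsCliquePacking A m P → Any Bad P) a →
                  ¬ ¬ GoodPacking t a
  ¬¬goodPacking ((P , packing , refl) , _) (holds _) noGood =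
    noGood (dropBad P , dropBad-packing packing , all-filter (¬? ∘ bad?) P , length≤1+length-dropBad P packing)
  ¬¬goodPacking ((P , packing , refl) , _) (fails notAlwaysBad) noGood =
    notAlwaysBad λ P′ (packing′ , maximum′) → decidable-stable (any? bad? P′) λ noBad →
      noGood (P′ , packing′ , ¬Any⇒All¬ P′ noBad , maximum′ P packing)

module OreComposition {n1 n2 : ℕ} (A1 : Graph (Fin n1)) (x y : Fin n1)
                      (A2 : Graph (Fin n2)) (z : Fin n2) (S : Fin n2 → Set) where

  G : Graph (OreV n1 n2 z)
  G = OreAdj A1 x y A2 z S

  open DecMembership (_≟_ {n1}) using () renaming (_∈?_ to _∈₁?_)
  open DecMembership (_≟_ {n2}) using () renaming (_∈?_ to _∈₂?_)

  UsesXY : List (Fin n1) → Set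
  UsesXY C = x ∈ C × y ∈ C

  usesXY? : Decidable UsesXY
  usesXY? C = x ∈₁? C ×-dec y ∈₁? C

  z∈? : Decidable (z ∈_)
  z∈? = z ∈₂?_

  ι₁ : Fin n1 → OreV n1 n2 z
  ι₁ = inj₁

  -- z itself has no vertex in G; the value chosen for it is never used.
  ι₂ : Fin n2 → OreV n1 n2 z
  ι₂ v with v ≟ z
  ... | yes _   = inj₁ x
  ... | no v≢z  = inj₂ (v , v≢z)

  forget₂ : OreV n1 n2 z → Fin n2
  forget₂ (inj₁ _)       = z
  forget₂ (inj₂ (v , _)) = v

  forget₂∘ι₂ : ∀ v → forget₂ (ι₂ v) ≡ v
  forget₂∘ι₂ v with v ≟ z
  ... | yes v≡z = sym v≡z
  ... | no _    = refl

  ι₁-injective : Injective _≡_ _≡_ ι₁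
  ι₁-injective refl = refl

  ι₂-injective : Injective _≡_ _≡_ ι₂
  ι₂-injective {u} {v} ι₂u≡ι₂v = trans (sym (forget₂∘ι₂ u)) (trans (cong forget₂ ι₂u≡ι₂v) (forget₂∘ι₂ v))

  ι₂≢ι₁ : ∀ {v a} → v ≢ z → ι₂ v ≢ ι₁ a
  ι₂≢ι₁ {v} v≢z with v ≟ z
  ... | yes v≡z = ⊥-elim (v≢z v≡z)
  ... | no _    = λ ()

  ι₂-adjacent : ∀ {u v} → u ≢ z → v ≢ z → A2 u v → G (ι₂ u) (ι₂ v)
  ι₂-adjacent {u} {v} u≢z v≢z uv with u ≟ z | v ≟ z
  ... | yes u≡z | _       = ⊥-elim (u≢z u≡z)
  ... | no _    | yes v≡z = ⊥-elim (v≢z v≡z)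
  ... | no _    | no _    = uv

  ι₁-homomorphicOn : ∀ {C} → ¬ UsesXY C → HomomorphicOn A1 G ι₁ C
  ι₁-homomorphicOn ¬xy u∈ v∈ uv = uv , λ
    { (inj₁ (refl , refl)) → ¬xy (u∈ , v∈)
    ; (inj₂ (refl , refl)) → ¬xy (v∈ , u∈) }

  ι₂-homomorphicOn : ∀ {C} → z ∉ C → HomomorphicOn A2 G ι₂ C
  ι₂-homomorphicOn z∉C u∈ v∈ = ι₂-adjacent (λ { refl → z∉C u∈ }) (λ { refl → z∉C v∈ })

  orePacking : List (List (Fin n1)) → List (List (Fin n2)) → List (List (OreV n1 n2 z))
  orePacking Q1 Q2 = map (map ι₁) Q1 ++ map (map ι₂) Q2

  length-orePacking : ∀ Q1 Q2 → length (orePacking Q1 Q2) ≡ length Q1 + length Q2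
  length-orePacking Q1 Q2 =
    trans (length-++ (map (map ι₁) Q1)) (cong₂ _+_ (length-map _ Q1) (length-map _ Q2))

  orePacking-packing : ∀ {m Q1 Q2} → IsPacking A1 m Q1 → All (∁ UsesXY) Q1 →
                       IsPacking A2 m Q2 → All (z ∉_) Q2 → IsPacking G m (orePacking Q1 Q2)
  orePacking-packing {Q1 = Q1} {Q2} packing₁ avoid₁ packing₂ avoid₂ =
    ++-packing (map-packing ι₁-injective (All.map ι₁-homomorphicOn avoid₁) packing₁)
               (map-packing ι₂-injective (All.map ι₂-homomorphicOn avoid₂) packing₂)
               sides-disjoint
    where
      sides-disjoint : Disjoint (concat (map (map ι₁) Q1)) (concat (map (map ι₂) Q2))
      sides-disjoint (p∈₁ , p∈₂)
        with ∈-map⁻ ι₁ (subst (_ ∈_) (concat-map Q1) p∈₁) | ∈-map⁻ ι₂ (subst (_ ∈_) (concat-map Q2) p∈₂)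
      ... | a , _ , refl | v , v∈ , ι₁a≡ι₂v with ∈-concat⁻′ Q2 v∈
      ... | C , v∈C , C∈Q2 =
        ι₂≢ι₁ (λ { refl → All.lookup avoid₂ C∈Q2 v∈C }) (sym ι₁a≡ι₂v)

proposition2p4 :
    (k n1 n2 : ℕ) → 2 ≤ k →
    (A1 : Graph (Fin n1)) → IsSimple A1 →
    (A2 : Graph (Fin n2)) → IsSimple A2 →
    (x y : Fin n1) → A1 x y →
    (z : Fin n2) → (S : Fin n2 → Set) →
    (Σ (Fin n2) λ v → A2 z v × S v) →
    (Σ (Fin n2) λ v → A2 z v × ¬ S v) →
    (t1 t2 t : ℕ) →
    IsT A1 (k ∸ 1) t1 → IsT A2 (k ∸ 1) t2 →
    IsT (OreAdj A1 x y A2 z S) (k ∸ 1) t →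
    (a b : ℕ) →
    Indicator (∀ P → IsCliquePacking A1 (k ∸ 1) P → Any (λ C → x ∈ C × y ∈ C) P) a →
    Indicator (∀ P → IsCliquePacking A2 (k ∸ 1) P → Any (λ C → z ∈ C) P) b →
    t1 + t2 ≤ t + (a + b)
proposition2p4 k _ _ _ A1 _ A2 _ x y _ z S _ _ t1 t2 t T1 T2 (_ , maximumG) a b always₁ always₂ =
  decidable-stable (t1 + t2 ≤? t + (a + b)) λ ¬goal →
    Side₁.¬¬goodPacking T1 always₁ λ (Q1 , packing₁ , avoid₁ , t1≤) →
    Side₂.¬¬goodPacking T2 always₂ λ (Q2 , packing₂ , avoid₂ , t2≤) →
    ¬goal (begin
      t1 + t2                                ≤⟨ +-mono-≤ t1≤ t2≤ ⟩
      (a + length Q1) + (b + length Q2)      ≡⟨ interchange a (length Q1) b (length Q2) ⟩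
      (a + b) + (length Q1 + length Q2)      ≡⟨ cong (a + b +_) (sym (length-orePacking Q1 Q2)) ⟩
      (a + b) + length (orePacking Q1 Q2)    ≤⟨ +-monoʳ-≤ (a + b) (maximumG _ (orePacking-packing packing₁ avoid₁ packing₂ avoid₂)) ⟩
      (a + b) + t                            ≡⟨ +-comm (a + b) t ⟩
      t + (a + b)                            ∎)
  where
    open OreComposition A1 x y A2 z S
    open ≤-Reasoning
    module Side₁ = DropBad A1 (k ∸ 1) usesXY? proj₁
    module Side₂ = DropBad A2 (k ∸ 1) z∈? (λ z∈C → z∈C)
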